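{- Let $r<n$ be positive integers. There is a randomized streaming algorithm solving $\mathrm{MIF}(n,r)$ with zero error against adaptive adversaries which uses $O((1 + r^2/n)\log r)$ bits of space, in expectation over the randomness of the algorithm.
   Context: For integers $r<n$, $\mathrm{MIF}(n,r)$ (Missing Item Finding): given a stream $a_1,\ldots,a_r\in[n]$ (repetitions allowed), output some $x\in[n]$ with $x\ne a_i$ for all $i$. The algorithm may be randomized with its initial state, transitions and outputs depending on a shared random variable (random oracle, whose bits are not counted in the space). Against adaptive adversaries: an adversary supplies $e_1,\ldots,e_r$, after each $e_i$ the algorithm outputs $o_i$ which must lie in $[n]\setminus\{e_1,\ldots,e_i\}$, and $e_i$ may depend on earlier outputs. Zero error means every output is correct with probability $1$ for every adversary. States are encoded by a prefix-free binary code; the cost is the worst-case expected number of bits of the state. Logarithms base 2. -}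

module Defs where

open import Data.Nat using (ℕ; zero; suc; _+_; _*_; _≤_; _<_)
open import Data.Nat.Logarithm using (⌈log₂_⌉)
open import Data.Fin using (Fin)
open import Data.Bool using (Bool)
open import Data.List using (List; []; _∷_; length; map; _++_; [_])
open import Data.Nat.ListAction using (sum)
open import Data.List.Membership.Propositional using (_∈_)
open import Data.Product using (Σ; ∃; _×_; _,_; proj₁; proj₂)
open import Relation.Binary.PropositionalEquality using (_≡_)
open import Relation.Nullary using (¬_)

IsPrefix : List Bool → List Bool → Set
IsPrefix u v = ∃ λ w → u ++ w ≡ v

-- The shared randomness is a uniformly random element of the finite,
-- nonempty list 'seeds' (multiplicities allowed).
record Alg (n : ℕ) : Set₁ where
  field
    Ω          : Set
    seeds      : List Ω
    seeds-ne   : 0 < length seeds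
    S          : Set
    enc        : S → List Bool
    prefixFree : ∀ s t → IsPrefix (enc s) (enc t) → s ≡ t
    init       : Ω → S
    step       : Ω → S → Fin n → S
    out        : Ω → S → Fin n

-- A deterministic adaptive adversary: the next stream element is chosen
-- as a function of the outputs o_1, ..., o_i seen so far (oldest first).
Adversary : ℕ → Set
Adversary n = List (Fin n) → Fin n

module _ {n : ℕ} (A : Alg n) where
  open Alg A

  Config : Set
  Config = S × List (Fin n) × List (Fin n)

  run : Ω → Adversary n → ℕ → Config
  run ω adv zero = init ω , [] , []
  run ω adv (suc k) with run ω adv k
  ... | s , es , os =
    let e  = adv os
        s' = step ω s e
    in s' , es ++ [ e ] , os ++ [ out ω s' ]

  stateAt : Ω → Adversary n → ℕ → S
  stateAt ω adv k = proj₁ (run ω adv k)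

  ZeroError : ℕ → Set
  ZeroError r = ∀ (adv : Adversary n) (ω : Ω) → ω ∈ seeds →
    ∀ k → 1 ≤ k → k ≤ r →
    ¬ (out ω (stateAt ω adv k) ∈ proj₁ (proj₂ (run ω adv k)))

  -- Sum over the seed list of the number of bits of the state after k steps
  -- (so the expected number of bits is  totalBits adv k / length seeds).
  totalBits : Adversary n → ℕ → ℕ
  totalBits adv k = sum (map (λ ω → length (enc (stateAt ω adv k))) seeds)

  -- Worst-case (over adversaries and times 0..r) expected number of bits
  -- is at most  C * (1 + r²/n) * (1 + ⌈log₂ r⌉), cleared of denominators.
  SpaceBound : ℕ → ℕ → Set
  SpaceBound C r = ∀ (adv : Adversary n) k → k ≤ r →
    n * totalBits adv k ≤ C * (n + r * r) * (1 + ⌈log₂ r ⌉) * length seeds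

-- The seed is a uniformly random injection y : Fin (r + 1) → Fin n.  The state is a pointer j,
-- whose value y j is the output, together with the list H of the indices i > j whose value y i
-- has already occurred in the stream.  When y j occurs, the pointer jumps to the first index
-- above j outside H; since r items cannot cover r + 1 distinct values, this never fails within
-- r steps, which gives zero error.  A state costs (1 + w)(2 + |H|) bits with w = 1 + ⌈log₂ r⌉.
-- An index i can enter H at step t only while it is untouched (above the pointer, not in H),
-- and then the run so far, hence the item the adversary names at step t, does not depend on
-- y i.  Resampling y i among the n − (r + 1) values outside y therefore shows that i enters
-- at step t for at most a 1/(n − r − 1) fraction of the seeds.  Summing over i and t gives
-- E|H| ≤ r (r + 1)/(n − r − 1); together with |H| ≤ r when n ≤ 2 (r + 1), this yields
-- n · E|H| ≤ 2 r (r + 1).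
module Submission where

open import Defs
open import Data.Nat as ℕ using (ℕ; zero; suc; _+_; _*_; _∸_; _^_; _≤_; _<_; _≤?_; z≤n; s≤s; ⌈_/2⌉; ⌊_/2⌋)
open import Data.Nat.Properties
open import Data.Nat.ListAction using (sum)
open import Data.Nat.Logarithm using (⌈log₂_⌉)
open import Data.Nat.Logarithm.Core using (⌈log2⌉)
open import Data.Nat.Induction using (<-wellFounded)
open import Induction.WellFounded using (Acc; acc)
open import Level using (Level)
open import Data.Bool using (Bool; true; false)
open import Data.Fin as Fin using (Fin; zero; suc; remQuot; combine)
import Data.Fin.Properties as Finₚ
open import Data.Maybe as Maybe using (Maybe; just; nothing)
import Data.Maybe.Properties as Maybeₚ
open import Data.List using (List; []; _∷_; _++_; [_]; length; map; filter; allFin; cartesianProduct)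
open import Data.List.Properties
  using (length-removeAt′; length-filter; length-++; length-map; length-tabulate; ∷-injective; ∷-injectiveʳ; ++-assoc; ++-identityʳ; filter-++)
open import Data.List.Membership.Propositional.Properties
  using (∈-length; ∈-++⁺ˡ; ∈-++⁺ʳ; ∈-++⁻; ∈-map⁺; ∈-allFin; ∈-filter⁺; ∈-filter⁻; ∈-cartesianProduct⁺; ∈-cartesianProduct⁻)
open import Data.List.Relation.Unary.Unique.Propositional.Properties
  using (allFin⁺; filter⁺; cartesianProduct⁺; map⁺)
open import Data.List.Membership.Propositional using (_∈_; _∉_)
open import Data.List.Relation.Unary.Any using (here; there; _─_)
open import Data.List.Relation.Unary.All as All using (All)
open import Data.List.Relation.Unary.AllPairs using ([]; _∷_)
open import Data.Vec as Vec using (Vec; lookup; _[_]≔_)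
import Data.Vec.Properties as Vecₚ
open import Data.List.Relation.Unary.Unique.Propositional using (Unique)
open import Data.Product using (Σ; ∃; _×_; _,_; proj₁; proj₂; uncurry)
open import Data.Empty using (⊥-elim)
open import Function using (id; _∘_; Inverse)
open import Relation.Nullary using (¬_; Dec; yes; no)
open import Relation.Nullary.Decidable using (¬?; map′; _×-dec_; _→-dec_)
open import Relation.Binary.Definitions using (Tri; tri<; tri≈; tri>)
open import Data.Sum using (_⊎_; inj₁; inj₂) renaming ([_,_] to either)
open import Function.Definitions using (Injective)
open import Relation.Unary using (Pred; Decidable)
open import Relation.Binary.PropositionalEquality hiding ([_])
open import Algebra.Properties.CommutativeSemigroup +-commutativeSemigroup
  using () renaming (interchange to +-interchange)
open import Data.Nat.Solver using (module +-*-Solver)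
open +-*-Solver using (solve; _:+_; _:*_; _:=_; con)

m+m≤n⇒n≤[n∸m]+[n∸m] : ∀ {m n} → m + m ≤ n → n ≤ (n ∸ m) + (n ∸ m)
m+m≤n⇒n≤[n∸m]+[n∸m] {m} {n} m+m≤n = begin
  n                   ≡⟨ m+[n∸m]≡n (≤-trans (m≤m+n m m) m+m≤n) ⟨
  m + (n ∸ m)         ≤⟨ +-monoˡ-≤ (n ∸ m) (m+n≤o⇒m≤o∸n m m+m≤n) ⟩
  (n ∸ m) + (n ∸ m)   ∎
  where open ≤-Reasoning

-- Counting in lists

module _ {a : Level} {A : Set a} where

  ∈-─ : ∀ {x y : A} {xs : List A} (p : x ∈ xs) → y ∈ xs → y ≢ x → y ∈ (xs ─ p)
  ∈-─ (here refl) (here refl) y≢x = ⊥-elim (y≢x refl)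
  ∈-─ (here _)    (there q)   _   = q
  ∈-─ (there p)   (here refl) _   = here refl
  ∈-─ (there p)   (there q)   y≢x = there (∈-─ p q y≢x)

  ++-split : ∀ (xs xs′ ys ys′ : List A) → length xs ≡ length xs′ →
             xs ++ ys ≡ xs′ ++ ys′ → xs ≡ xs′ × ys ≡ ys′
  ++-split []       []        ys ys′ _   eq = refl , eq
  ++-split (x ∷ xs) (x′ ∷ xs′) ys ys′ len eq
    with refl , eq′ ← ∷-injective eq
    with refl , refl ← ++-split xs xs′ ys ys′ (suc-injective len) eq′ = refl , refl

module _ {a b : Level} {A : Set a} {B : Set b} where

  injective⇒length≤ : ∀ (f : A → B) {xs : List A} {ys : List B} → Unique xs →
    (∀ {x} → x ∈ xs → f x ∈ ys) →
    (∀ {x x′} → x ∈ xs → x′ ∈ xs → f x ≡ f x′ → x ≡ x′) →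
    length xs ≤ length ys
  injective⇒length≤ f {[]}     _            _    _   = z≤n
  injective⇒length≤ f {x ∷ xs} {ys} (x∉xs ∷ u) into inj =
    subst (suc (length xs) ≤_) (sym (length-removeAt′ ys _))
      (s≤s (injective⇒length≤ f u into′ (λ p q → inj (there p) (there q))))
    where
      fx∈ys = into (here refl)
      into′ : ∀ {x′} → x′ ∈ xs → f x′ ∈ (ys ─ fx∈ys)
      into′ {x′} p = ∈-─ fx∈ys (into (there p))
        (λ fx′≡fx → All.lookup x∉xs p (inj (here refl) (there p) (sym fx′≡fx)))

indicator : ∀ {p} {P : Set p} → Dec P → ℕ
indicator (yes _) = 1
indicator (no _)  = 0

module _ {a : Level} {A : Set a} where

  sum-map-zero : ∀ (xs : List A) → sum (map (λ _ → 0) xs) ≡ 0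
  sum-map-zero []       = refl
  sum-map-zero (_ ∷ xs) = sum-map-zero xs

  sum-map-mono : ∀ (f g : A → ℕ) xs → (∀ x → f x ≤ g x) → sum (map f xs) ≤ sum (map g xs)
  sum-map-mono f g []       _   = z≤n
  sum-map-mono f g (x ∷ xs) f≤g = +-mono-≤ (f≤g x) (sum-map-mono f g xs f≤g)

  sum-map-≤-const : ∀ (f : A → ℕ) c xs → (∀ x → f x ≤ c) → sum (map f xs) ≤ length xs * c
  sum-map-≤-const f c []       _   = z≤n
  sum-map-≤-const f c (x ∷ xs) f≤c = +-mono-≤ (f≤c x) (sum-map-≤-const f c xs f≤c)

  sum-map-+ : ∀ (f g : A → ℕ) xs → sum (map (λ x → f x + g x) xs) ≡ sum (map f xs) + sum (map g xs)
  sum-map-+ f g []       = refl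
  sum-map-+ f g (x ∷ xs) = begin
    (f x + g x) + sum (map (λ x → f x + g x) xs)      ≡⟨ cong (f x + g x +_) (sum-map-+ f g xs) ⟩
    (f x + g x) + (sum (map f xs) + sum (map g xs))   ≡⟨ +-interchange (f x) (g x) _ _ ⟩
    (f x + sum (map f xs)) + (g x + sum (map g xs))   ∎
    where open ≡-Reasoning

  sum-map-*ˡ : ∀ c (f : A → ℕ) xs → sum (map (λ x → c * f x) xs) ≡ c * sum (map f xs)
  sum-map-*ˡ c f []       = sym (*-zeroʳ c)
  sum-map-*ˡ c f (x ∷ xs) = trans (cong (c * f x +_) (sum-map-*ˡ c f xs)) (sym (*-distribˡ-+ c (f x) _))

  length-filter≡sum-indicator : ∀ {p} {P : Pred A p} (P? : Decidable P) xs →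
    length (filter P? xs) ≡ sum (map (indicator ∘ P?) xs)
  length-filter≡sum-indicator P? []       = refl
  length-filter≡sum-indicator P? (x ∷ xs) with P? x
  ... | yes _ = cong suc (length-filter≡sum-indicator P? xs)
  ... | no _  = length-filter≡sum-indicator P? xs

  indicator-∈ : ∀ {p} {P : Pred A p} (P? : Decidable P) {x} xs → x ∈ xs → P x →
    1 ≤ sum (map (indicator ∘ P?) xs)
  indicator-∈ P? (y ∷ xs) (here refl) px with P? y
  ... | yes _  = s≤s z≤n
  ... | no ¬px = ⊥-elim (¬px px)
  indicator-∈ P? (y ∷ xs) (there x∈xs) px =
    ≤-trans (indicator-∈ P? xs x∈xs px) (m≤n+m _ (indicator (P? y)))

size : ∀ {a} {A : Set a} → Maybe A → ℕ
size nothing  = 0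
size (just _) = 1

size≤1 : ∀ {a} {A : Set a} (m : Maybe A) → size m ≤ 1
size≤1 nothing  = z≤n
size≤1 (just _) = s≤s z≤n

size≤sum-indicator : ∀ {k} (m : Maybe (Fin k)) →
  size m ≤ sum (map (λ i → indicator (Maybeₚ.≡-dec Fin._≟_ m (just i))) (allFin k))
size≤sum-indicator         nothing  = z≤n
size≤sum-indicator {k = k} (just i) =
  indicator-∈ (λ i′ → Maybeₚ.≡-dec Fin._≟_ (just i) (just i′)) (allFin k) (∈-allFin i) refl

module _ {a b : Level} {A : Set a} {B : Set b} where

  sum-map-comm : ∀ (f : A → B → ℕ) xs ys →
    sum (map (λ x → sum (map (f x) ys)) xs) ≡ sum (map (λ y → sum (map (λ x → f x y) xs)) ys)
  sum-map-comm f []       ys = sym (sum-map-zero ys)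
  sum-map-comm f (x ∷ xs) ys =
    trans (cong (sum (map (f x) ys) +_) (sum-map-comm f xs ys))
          (sym (sum-map-+ (f x) (λ y → sum (map (λ x → f x y) xs)) ys))

data First {k p} (P : Pred (Fin k) p) : Maybe (Fin k) → Set p where
  found : ∀ {i} → P i → (∀ {l} → l Fin.< i → ¬ P l) → First P (just i)
  none  : (∀ l → ¬ P l) → First P nothing

module _ {p : Level} where

  first : ∀ {k} {P : Pred (Fin k) p} → Decidable P → Maybe (Fin k)
  first {zero}  P? = nothing
  first {suc k} P? with P? zero
  ... | yes _ = just zero
  ... | no _  = Maybe.map suc (first (P? ∘ suc))

  first-spec : ∀ {k} {P : Pred (Fin k) p} (P? : Decidable P) → First P (first P?)
  first-spec {zero}  P? = none λ ()
  first-spec {suc k} {P} P? with P? zero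
  ... | yes p₀ = found p₀ λ ()
  ... | no ¬p₀ with first (P? ∘ suc) | first-spec (P? ∘ suc)
  ...   | just i  | found pᵢ minimal = found pᵢ minimal′
    where
      minimal′ : ∀ {l} → l Fin.< suc i → ¬ P l
      minimal′ {zero}  _         = ¬p₀
      minimal′ {suc l} (s≤s l<i) = minimal l<i
  ...   | nothing | none ¬p = none ¬p′
    where
      ¬p′ : ∀ l → ¬ P l
      ¬p′ zero    = ¬p₀
      ¬p′ (suc l) = ¬p l

first-cong : ∀ {k p q} {P : Pred (Fin k) p} {Q : Pred (Fin k) q} (P? : Decidable P) (Q? : Decidable Q) →
  (∀ i → P i → Q i) → (∀ i → Q i → P i) → first P? ≡ first Q?
first-cong {zero}  P? Q? P⇒Q Q⇒P = refl
first-cong {suc k} P? Q? P⇒Q Q⇒P with P? zero | Q? zero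
... | yes _  | yes _  = refl
... | yes p₀ | no ¬q₀ = ⊥-elim (¬q₀ (P⇒Q zero p₀))
... | no ¬p₀ | yes q₀ = ⊥-elim (¬p₀ (Q⇒P zero q₀))
... | no _   | no _   = cong (Maybe.map suc)
                          (first-cong (P? ∘ suc) (Q? ∘ suc) (P⇒Q ∘ suc) (Q⇒P ∘ suc))

-- Binary codes

bits : ∀ w → Fin (2 ^ w) → List Bool
bits zero    _ = []
bits (suc w) i = let b , i′ = remQuot (2 ^ w) i in Inverse.to Finₚ.2↔Bool b ∷ bits w i′

length-bits : ∀ w i → length (bits w i) ≡ w
length-bits zero    _ = refl
length-bits (suc w) _ = cong suc (length-bits w _)

bits-injective : ∀ w {i j} → bits w i ≡ bits w j → i ≡ j
bits-injective zero    {zero} {zero} _  = refl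
bits-injective (suc w) {i} {j} eq with b≡ , i≡ ← ∷-injective eq = begin
  i                                 ≡⟨ Finₚ.combine-remQuot (2 ^ w) i ⟨
  uncurry combine (remQuot (2 ^ w) i) ≡⟨ cong₂ combine (to-injective b≡) (bits-injective w i≡) ⟩
  uncurry combine (remQuot (2 ^ w) j) ≡⟨ Finₚ.combine-remQuot (2 ^ w) j ⟩
  j                                 ∎
  where
    open ≡-Reasoning
    open Inverse Finₚ.2↔Bool using (to; from; strictlyInverseʳ)
    to-injective : ∀ {b c} → to b ≡ to c → b ≡ c
    to-injective {b} {c} eq = trans (sym (strictlyInverseʳ b)) (trans (cong from eq) (strictlyInverseʳ c))

≤2^⌈log₂⌉ : ∀ n → n ≤ 2 ^ ⌈log₂ n ⌉
≤2^⌈log₂⌉ n = go n (<-wellFounded n)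
  where
    go : ∀ n (rec : Acc _<_ n) → n ≤ 2 ^ ⌈log2⌉ n rec
    go zero          _         = z≤n
    go (suc zero)    _         = s≤s z≤n
    go (suc (suc n)) (acc rec) = begin
      2 + n                     ≡⟨ cong (2 +_) (⌊n/2⌋+⌈n/2⌉≡n n) ⟨
      2 + (⌊ n /2⌋ + ⌈ n /2⌉)   ≤⟨ s≤s (s≤s (+-monoˡ-≤ ⌈ n /2⌉ (⌊n/2⌋≤⌈n/2⌉ n))) ⟩
      2 + (⌈ n /2⌉ + ⌈ n /2⌉)   ≡⟨ cong suc (sym (+-suc ⌈ n /2⌉ ⌈ n /2⌉)) ⟩
      suc ⌈ n /2⌉ + suc ⌈ n /2⌉ ≤⟨ +-mono-≤ half≤ (≤-trans half≤ (m≤m+n _ 0)) ⟩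
      2 ^ ⌈log2⌉ (suc (suc n)) (acc rec)  ∎
      where
        open ≤-Reasoning
        half≤ = go (suc ⌈ n /2⌉) _

module FixedWidthCode {a : Level} {A : Set a} (w : ℕ) (code : A → List Bool)
  (length-code : ∀ x → length (code x) ≡ w)
  (code-injective : ∀ {x y} → code x ≡ code y → x ≡ y) where

  code-++-injective : ∀ {x y} u v → code x ++ u ≡ code y ++ v → x ≡ y × u ≡ v
  code-++-injective {x} {y} u v eq
    with cx≡cy , u≡v ← ++-split (code x) (code y) u v (trans (length-code x) (sym (length-code y))) eq
    = code-injective cx≡cy , u≡v

  codeList : List A → List Bool
  codeList []       = [ false ]
  codeList (x ∷ xs) = true ∷ code x ++ codeList xs

  codePair : A × List A → List Bool
  codePair (x , xs) = code x ++ codeList xs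

  codeList-prefixFree : ∀ xs ys u v → codeList xs ++ u ≡ codeList ys ++ v → xs ≡ ys
  codeList-prefixFree []       []       _ _ _  = refl
  codeList-prefixFree (x ∷ xs) (y ∷ ys) u v eq
    with refl , rest ← code-++-injective (codeList xs ++ u) (codeList ys ++ v)
                         (trans (sym (++-assoc (code x) _ u))
                           (trans (∷-injectiveʳ eq) (++-assoc (code y) _ v)))
    = cong (x ∷_) (codeList-prefixFree xs ys u v rest)

  codePair-prefixFree : ∀ s t → IsPrefix (codePair s) (codePair t) → s ≡ t
  codePair-prefixFree (x , xs) (y , ys) (u , eq)
    with refl , rest ← code-++-injective (codeList xs ++ u) (codeList ys ++ [])
                         (trans (sym (++-assoc (code x) _ u))
                           (trans eq (cong (code y ++_) (sym (++-identityʳ (codeList ys))))))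
    = cong (x ,_) (codeList-prefixFree xs ys u [] rest)

  length-codeList : ∀ xs → length (codeList xs) ≡ suc (length xs * suc w)
  length-codeList []       = refl
  length-codeList (x ∷ xs) = cong suc (begin
    length (code x ++ codeList xs)        ≡⟨ length-++ (code x) ⟩
    length (code x) + length (codeList xs) ≡⟨ cong₂ _+_ (length-code x) (length-codeList xs) ⟩
    w + suc (length xs * suc w)           ≡⟨ +-suc w _ ⟩
    suc w + length xs * suc w             ∎)
    where open ≡-Reasoning

  length-codePair : ∀ x xs → length (codePair (x , xs)) ≤ suc w * (2 + length xs)
  length-codePair x xs = begin
    length (code x ++ codeList xs)   ≡⟨ length-++ (code x) ⟩
    length (code x) + length (codeList xs) ≡⟨ cong₂ _+_ (length-code x) (length-codeList xs) ⟩
    w + suc (length xs * suc w)      ≡⟨ +-suc w _ ⟩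
    suc w + length xs * suc w        ≤⟨ m≤n+m _ (suc w) ⟩
    (2 + length xs) * suc w          ≡⟨ *-comm (2 + length xs) (suc w) ⟩
    suc w * (2 + length xs)          ∎
    where open ≤-Reasoning

module _ {a b : Level} {A : Set a} {B : Set b} where

  length-filter-map-, : ∀ {p} {Q : Pred (A × B) p} (Q? : Decidable Q) x ys →
    length (filter Q? (map (x ,_) ys)) ≡ length (filter (Q? ∘ (x ,_)) ys)
  length-filter-map-, Q? x []       = refl
  length-filter-map-, Q? x (y ∷ ys) with Q? (x , y)
  ... | yes _ = cong suc (length-filter-map-, Q? x ys)
  ... | no _  = length-filter-map-, Q? x ys

  *≤length-filter-cartesianProduct : ∀ {p} {Q : Pred (A × B) p} (Q? : Decidable Q) c xs ys →
    (∀ {x} → x ∈ xs → c ≤ length (filter (Q? ∘ (x ,_)) ys)) →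
    length xs * c ≤ length (filter Q? (cartesianProduct xs ys))
  *≤length-filter-cartesianProduct Q? c []       ys _     = z≤n
  *≤length-filter-cartesianProduct Q? c (x ∷ xs) ys enough = begin
    c + length xs * c
      ≤⟨ +-mono-≤ (enough (here refl)) (*≤length-filter-cartesianProduct Q? c xs ys (enough ∘ there)) ⟩
    length (filter (Q? ∘ (x ,_)) ys) + length (filter Q? (cartesianProduct xs ys))
      ≡⟨ cong (_+ _) (length-filter-map-, Q? x ys) ⟨
    length (filter Q? (map (x ,_) ys)) + length (filter Q? (cartesianProduct xs ys))
      ≡⟨ length-++ (filter Q? (map (x ,_) ys)) ⟨
    length (filter Q? (map (x ,_) ys) ++ filter Q? (cartesianProduct xs ys))
      ≡⟨ cong length (filter-++ Q? (map (x ,_) ys) _) ⟨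
    length (filter Q? (cartesianProduct (x ∷ xs) ys))
      ∎
    where open ≤-Reasoning

-- Injective vectors

module InjectiveVectors (n : ℕ) where

  vectors : ∀ k → List (Vec (Fin n) k)
  vectors zero    = [ Vec.[] ]
  vectors (suc k) = map (uncurry Vec._∷_) (cartesianProduct (allFin n) (vectors k))

  ∈-vectors : ∀ {k} (v : Vec (Fin n) k) → v ∈ vectors k
  ∈-vectors Vec.[]       = here refl
  ∈-vectors (x Vec.∷ v) = ∈-map⁺ (uncurry Vec._∷_) (∈-cartesianProduct⁺ (∈-allFin x) (∈-vectors v))

  vectors-unique : ∀ k → Unique (vectors k)
  vectors-unique zero    = All.[] ∷ []
  vectors-unique (suc k) = map⁺ ∷-injective′ (cartesianProduct⁺ (allFin⁺ n) (vectors-unique k))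
    where
      ∷-injective′ : ∀ {p q : Fin n × Vec (Fin n) k} → uncurry Vec._∷_ p ≡ uncurry Vec._∷_ q → p ≡ q
      ∷-injective′ {_ , _} {_ , _} refl = refl

  module _ {k : ℕ} where

    IsInjective : Vec (Fin n) k → Set
    IsInjective y = Injective _≡_ _≡_ (lookup y)

    isInjective? : Decidable IsInjective
    isInjective? y = map′ (λ inj {a} {b} → inj a b) (λ inj a b → inj {a} {b})
      (Finₚ.all? λ a → Finₚ.all? λ b → (lookup y a Fin.≟ lookup y b) →-dec (a Fin.≟ b))

    injectives : List (Vec (Fin n) k)
    injectives = filter isInjective? (vectors k)

    ∈-injectives : ∀ y → IsInjective y → y ∈ injectives
    ∈-injectives y inj = ∈-filter⁺ isInjective? (∈-vectors y) inj

    injectives-injective : ∀ {y} → y ∈ injectives → IsInjective y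
    injectives-injective y∈ = proj₂ (∈-filter⁻ isInjective? {xs = vectors k} y∈)

    Fresh : Vec (Fin n) k → Fin n → Set
    Fresh y a = ¬ ∃ λ l → lookup y l ≡ a

    fresh? : ∀ y → Decidable (Fresh y)
    fresh? y a = ¬? (Finₚ.any? λ l → lookup y l Fin.≟ a)

    ∸≤length-fresh : ∀ y → n ∸ k ≤ length (filter (fresh? y) (allFin n))
    ∸≤length-fresh y = m≤n+o⇒m∸n≤o n k (begin
      n                                               ≡⟨ length-tabulate id ⟨
      length (allFin n)                               ≤⟨ injective⇒length≤ id (allFin⁺ n) covered id′ ⟩
      length (map (lookup y) (allFin k) ++ freshes)  ≡⟨ length-++ (map (lookup y) (allFin k)) ⟩
      length (map (lookup y) (allFin k)) + length freshes
        ≡⟨ cong (_+ length freshes) (trans (length-map (lookup y) (allFin k)) (length-tabulate {n = k} id)) ⟩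
      k + length freshes                              ∎)
      where
        open ≤-Reasoning
        id′ : ∀ {a b : Fin n} → a ∈ allFin n → b ∈ allFin n → a ≡ b → a ≡ b
        id′ _ _ eq = eq
        freshes = filter (fresh? y) (allFin n)
        covered : ∀ {a} → a ∈ allFin n → a ∈ map (lookup y) (allFin k) ++ freshes
        covered {a} _ with Finₚ.any? (λ l → lookup y l Fin.≟ a)
        ... | yes (l , refl) = ∈-++⁺ˡ (∈-map⁺ (lookup y) (∈-allFin l))
        ... | no ¬hit        = ∈-++⁺ʳ _ (∈-filter⁺ (fresh? y) (∈-allFin a) ¬hit)

    update-injective : ∀ y i {a} → IsInjective y → Fresh y a → IsInjective (y [ i ]≔ a)
    update-injective y i {a} inj fresh {b} {c} eq with b Fin.≟ i | c Fin.≟ i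
    ... | yes refl | yes refl = refl
    ... | yes refl | no c≢i   = ⊥-elim (fresh (c , sym (begin
      a                    ≡⟨ Vecₚ.lookup∘update b y a ⟨
      lookup (y [ b ]≔ a) b ≡⟨ eq ⟩
      lookup (y [ b ]≔ a) c ≡⟨ Vecₚ.lookup∘update′ c≢i y a ⟩
      lookup y c           ∎)))
      where open ≡-Reasoning
    ... | no b≢i   | yes refl = ⊥-elim (fresh (b , (begin
      lookup y b           ≡⟨ Vecₚ.lookup∘update′ b≢i y a ⟨
      lookup (y [ c ]≔ a) b ≡⟨ eq ⟩
      lookup (y [ c ]≔ a) c ≡⟨ Vecₚ.lookup∘update c y a ⟩
      a                    ∎)))
      where open ≡-Reasoning
    ... | no b≢i   | no c≢i   =
      inj (trans (sym (Vecₚ.lookup∘update′ b≢i y a)) (trans eq (Vecₚ.lookup∘update′ c≢i y a)))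

    EqualExcept : Fin k → Vec (Fin n) k → Vec (Fin n) k → Set
    EqualExcept i x x′ = ∀ l → l ≢ i → lookup x l ≡ lookup x′ l

    -- (x , a) ↦ x [ i ]≔ a is injective on pairs of an event seed and a fresh value, since an
    -- event seed is determined by its coordinates other than i.
    resampling-bound : ∀ (i : Fin k) {p} {Ev : Pred (Vec (Fin n) k) p} (Ev? : Decidable Ev) →
      (∀ {x x′} → IsInjective x → IsInjective x′ → EqualExcept i x x′ → Ev x → Ev x′ →
                  lookup x i ≡ lookup x′ i) →
      (n ∸ k) * length (filter Ev? injectives) ≤ length injectives
    resampling-bound i {Ev = Ev} Ev? determined = let open ≤-Reasoning in begin
      (n ∸ k) * length events
        ≡⟨ *-comm (n ∸ k) (length events) ⟩
      length events * (n ∸ k)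
        ≤⟨ *≤length-filter-cartesianProduct fresh-pair? (n ∸ k) events (allFin n) (λ {x} _ → ∸≤length-fresh x) ⟩
      length pairs
        ≤⟨ injective⇒length≤ resample pairs-unique resample-∈ resample-injective ⟩
      length injectives
        ∎
      where
        events = filter Ev? injectives

        fresh-pair? : Decidable (uncurry Fresh)
        fresh-pair? (x , a) = fresh? x a

        pairs = filter fresh-pair? (cartesianProduct events (allFin n))

        pairs-unique : Unique pairs
        pairs-unique = filter⁺ fresh-pair?
          (cartesianProduct⁺ (filter⁺ Ev? (filter⁺ isInjective? (vectors-unique k))) (allFin⁺ n))

        ∈-pairs⁻ : ∀ {x a} → (x , a) ∈ pairs → (IsInjective x × Ev x) × Fresh x a
        ∈-pairs⁻ xa∈ with xa∈prod , fresh ← ∈-filter⁻ fresh-pair? {xs = cartesianProduct events (allFin n)} xa∈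
                   with x∈events , _ ← ∈-cartesianProduct⁻ events (allFin n) xa∈prod
                   with x∈injectives , ev ← ∈-filter⁻ Ev? {xs = injectives} x∈events
          = (injectives-injective x∈injectives , ev) , fresh

        resample : Vec (Fin n) k × Fin n → Vec (Fin n) k
        resample (x , a) = x [ i ]≔ a

        resample-∈ : ∀ {p} → p ∈ pairs → resample p ∈ injectives
        resample-∈ {x , a} p∈ with (inj , _) , fresh ← ∈-pairs⁻ p∈ =
          ∈-injectives (x [ i ]≔ a) (update-injective x i inj fresh)

        resample-injective : ∀ {p q} → p ∈ pairs → q ∈ pairs → resample p ≡ resample q → p ≡ q
        resample-injective {x , a} {x′ , a′} p∈ q∈ eq
          with (inj , ev) , _ ← ∈-pairs⁻ p∈
          with (inj′ , ev′) , _ ← ∈-pairs⁻ q∈ = cong₂ _,_ x≡x′ a≡a′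
          where
            open ≡-Reasoning
            a≡a′ : a ≡ a′
            a≡a′ = begin
              a                       ≡⟨ Vecₚ.lookup∘update i x a ⟨
              lookup (x [ i ]≔ a) i    ≡⟨ cong (λ v → lookup v i) eq ⟩
              lookup (x′ [ i ]≔ a′) i  ≡⟨ Vecₚ.lookup∘update i x′ a′ ⟩
              a′                      ∎
            except : EqualExcept i x x′
            except l l≢i = begin
              lookup x l              ≡⟨ Vecₚ.lookup∘update′ l≢i x a ⟨
              lookup (x [ i ]≔ a) l    ≡⟨ cong (λ v → lookup v l) eq ⟩
              lookup (x′ [ i ]≔ a′) l  ≡⟨ Vecₚ.lookup∘update′ l≢i x′ a′ ⟩
              lookup x′ l             ∎
            x≡x′ : x ≡ x′
            x≡x′ = begin
              x                                   ≡⟨ Vecₚ.[]≔-lookup x i ⟨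
              x [ i ]≔ lookup x i                 ≡⟨ cong (x [ i ]≔_) (determined inj inj′ except ev ev′) ⟩
              x [ i ]≔ lookup x′ i                ≡⟨ Vecₚ.[]≔-idempotent x i ⟨
              (x [ i ]≔ a) [ i ]≔ lookup x′ i      ≡⟨ cong (_[ i ]≔ lookup x′ i) eq ⟩
              (x′ [ i ]≔ a′) [ i ]≔ lookup x′ i    ≡⟨ Vecₚ.[]≔-idempotent x′ i ⟩
              x′ [ i ]≔ lookup x′ i               ≡⟨ Vecₚ.[]≔-lookup x′ i ⟩
              x′                                  ∎

-- The pointer algorithm

module PointerAlgorithm (n r : ℕ) where

  R : ℕ
  R = suc r

  Seed : Set
  Seed = Vec (Fin n) R

  State : Set
  State = Fin R × List (Fin R)

  open import Data.List.Membership.DecPropositional (Fin._≟_ {R}) using (_∈?_)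

  valueAt? : (y : Seed) (e : Fin n) → Decidable (λ l → lookup y l ≡ e)
  valueAt? y e l = lookup y l Fin.≟ e

  position : Seed → Fin n → Maybe (Fin R)
  position y e = first (valueAt? y e)

  Unhit : Fin R → List (Fin R) → Fin R → Set
  Unhit j H k = j Fin.< k × k ∉ H

  unhit? : ∀ j H → Decidable (Unhit j H)
  unhit? j H k = (j Finₚ.<? k) ×-dec ¬? (k ∈? H)

  nextUnhit : Fin R → List (Fin R) → Maybe (Fin R)
  nextUnhit j H = first (unhit? j H)

  -- The case nothing does not arise within r steps (tracks-advance).
  moveTo : State → Maybe (Fin R) → State
  moveTo s       nothing  = s
  moveTo (_ , H) (just k) = k , filter (k Finₚ.<?_) H

  react : (j i : Fin R) (H : List (Fin R)) → Tri (j Fin.< i) (j ≡ i) (i Fin.< j) → Dec (i ∈ H) → State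
  react j i H (tri< _ _ _) (no _)  = j , i ∷ H
  react j i H (tri< _ _ _) (yes _) = j , H
  react j i H (tri≈ _ _ _) _       = moveTo (j , H) (nextUnhit j H)
  react j i H (tri> _ _ _) _       = j , H

  reactEntry : (j i : Fin R) (H : List (Fin R)) → Tri (j Fin.< i) (j ≡ i) (i Fin.< j) → Dec (i ∈ H) → Maybe (Fin R)
  reactEntry j i H (tri< _ _ _) (no _) = just i
  reactEntry j i H _            _      = nothing

  transition : State → Maybe (Fin R) → State
  transition s       nothing  = s
  transition (j , H) (just i) = react j i H (Finₚ.<-cmp j i) (i ∈? H)

  entry : State → Maybe (Fin R) → Maybe (Fin R)
  entry s       nothing  = nothing
  entry (j , H) (just i) = reactEntry j i H (Finₚ.<-cmp j i) (i ∈? H)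

  step : Seed → State → Fin n → State
  step y s e = transition s (position y e)

  open InjectiveVectors n using (IsInjective; EqualExcept)

  Untouched : Fin R → State → Set
  Untouched i (j , H) = j Fin.< i × i ∉ H

  length-react : ∀ j i H c d → length (proj₂ (react j i H c d)) ≤ length H + size (reactEntry j i H c d)
  length-react j i H (tri< _ _ _) (no _)  = ≤-reflexive (+-comm 1 (length H))
  length-react j i H (tri< _ _ _) (yes _) = m≤m+n _ 0
  length-react j i H (tri≈ _ _ _) _ with nextUnhit j H
  ... | nothing = m≤m+n _ 0
  ... | just k  = ≤-trans (length-filter (k Finₚ.<?_) H) (m≤m+n _ 0)
  length-react j i H (tri> _ _ _) _       = m≤m+n _ 0

  length-transition : ∀ s m → length (proj₂ (transition s m)) ≤ length (proj₂ s) + size (entry s m)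
  length-transition s       nothing  = m≤m+n _ 0
  length-transition (j , H) (just i) = length-react j i H (Finₚ.<-cmp j i) (i ∈? H)

  untouched-react⁻ : ∀ {l} j i H c d → Untouched l (react j i H c d) → Untouched l (j , H)
  untouched-react⁻ j i H (tri< _ _ _) (no _)  (j<l , l∉i∷H) = j<l , l∉i∷H ∘ there
  untouched-react⁻ j i H (tri< _ _ _) (yes _) u             = u
  untouched-react⁻ j i H (tri> _ _ _) _       u             = u
  untouched-react⁻ {l} j i H (tri≈ _ _ _) _ u = go (nextUnhit j H) (first-spec (unhit? j H)) u
    where
      go : ∀ m → First (Unhit j H) m → Untouched l (moveTo (j , H) m) → Untouched l (j , H)
      go nothing  _                 u             = u
      go (just k) (found (j<k , _) _) (k<l , l∉H′) =
        Finₚ.<-trans j<k k<l , λ l∈H → l∉H′ (∈-filter⁺ (k Finₚ.<?_) l∈H k<l)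

  untouched-transition⁻ : ∀ {l} s m → Untouched l (transition s m) → Untouched l s
  untouched-transition⁻ s       nothing  u = u
  untouched-transition⁻ (j , H) (just i) u = untouched-react⁻ j i H (Finₚ.<-cmp j i) (i ∈? H) u

  hit-while-untouched : ∀ {i} s → Untouched i s → ¬ Untouched i (transition s (just i))
  hit-while-untouched {i} (j , H) (j<i , i∉H) with Finₚ.<-cmp j i | i ∈? H
  ... | tri< _ _ _    | no _    = λ (_ , i∉i∷H) → i∉i∷H (here refl)
  ... | tri< _ _ _    | yes i∈H = λ _ → i∉H i∈H
  ... | tri≈ _ j≡i _  | _       = λ _ → Finₚ.<⇒≢ j<i j≡i
  ... | tri> ¬j<i _ _ | _       = λ _ → ¬j<i j<i

  entry-just : ∀ {i} s m → entry s m ≡ just i → m ≡ just i × Untouched i s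
  entry-just (j , H) (just i) eq with Finₚ.<-cmp j i | i ∈? H
  entry-just (j , H) (just i) refl | tri< j<i _ _ | no i∉H = refl , j<i , i∉H

  position-hit : ∀ y {i e} → IsInjective y → lookup y i ≡ e → position y e ≡ just i
  position-hit y {i} {e} inj yᵢ≡e with position y e | first-spec (valueAt? y e)
  ... | nothing | none miss     = ⊥-elim (miss i yᵢ≡e)
  ... | just l  | found yₗ≡e _ = cong just (inj (trans yₗ≡e (sym yᵢ≡e)))

  position-sound : ∀ y {i e} → position y e ≡ just i → lookup y i ≡ e
  position-sound y {i} {e} eq with position y e | first-spec (valueAt? y e)
  position-sound y refl | just _ | found yᵢ≡e _ = yᵢ≡e

  position-agree : ∀ x x′ {i e} → EqualExcept i x x′ → lookup x i ≢ e → lookup x′ i ≢ e →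
    position x e ≡ position x′ e
  position-agree x x′ {i} {e} except xᵢ≢e x′ᵢ≢e =
    first-cong (valueAt? x e) (valueAt? x′ e) there′ back
    where
      there′ : ∀ l → lookup x l ≡ e → lookup x′ l ≡ e
      there′ l xₗ≡e with l Fin.≟ i
      ... | yes refl = ⊥-elim (xᵢ≢e xₗ≡e)
      ... | no l≢i   = trans (sym (except l l≢i)) xₗ≡e
      back : ∀ l → lookup x′ l ≡ e → lookup x l ≡ e
      back l x′ₗ≡e with l Fin.≟ i
      ... | yes refl = ⊥-elim (x′ᵢ≢e x′ₗ≡e)
      ... | no l≢i   = trans (except l l≢i) x′ₗ≡e


  module Tracking (y : Seed) (y-injective : IsInjective y) where

    Seen : List (Fin n) → Fin R → Set
    Seen es l = lookup y l ∈ es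

    record TracksAt (j : Fin R) (H : List (Fin R)) (es : List (Fin n)) : Set where
      field
        pointer-unseen : ¬ Seen es j
        below-seen     : ∀ {l} → l Fin.< j → Seen es l
        hit⇒seen       : ∀ {l} → j Fin.< l → l ∈ H → Seen es l
        seen⇒hit       : ∀ {l} → j Fin.< l → Seen es l → l ∈ H

    Tracks : State → List (Fin n) → Set
    Tracks (j , H) = TracksAt j H

    tracks-init : Tracks (zero , []) []
    tracks-init = record { pointer-unseen = λ () ; below-seen = λ () ; hit⇒seen = λ _ () ; seen⇒hit = λ _ () }

    all-seen⇒R≤length : ∀ {es} → (∀ l → Seen es l) → R ≤ length es
    all-seen⇒R≤length {es} all-seen = subst (_≤ length es) (length-tabulate {n = R} id)
      (injective⇒length≤ (lookup y) (allFin⁺ R) (λ {l} _ → all-seen l) (λ _ _ → y-injective))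

    module _ {es : List (Fin n)} {e : Fin n} where

      seen-++⁺ : ∀ {l} → Seen es l → Seen (es ++ [ e ]) l
      seen-++⁺ = ∈-++⁺ˡ

      seen-new : ∀ {i} → lookup y i ≡ e → Seen (es ++ [ e ]) i
      seen-new yᵢ≡e = ∈-++⁺ʳ es (here yᵢ≡e)

      seen-++⁻ : ∀ {i l} → lookup y i ≡ e → Seen (es ++ [ e ]) l → Seen es l ⊎ l ≡ i
      seen-++⁻ yᵢ≡e seen with ∈-++⁻ es seen
      ... | inj₁ old          = inj₁ old
      ... | inj₂ (here yₗ≡e) = inj₂ (y-injective (trans yₗ≡e (sym yᵢ≡e)))

      seen-++-miss : (∀ l → lookup y l ≢ e) → ∀ {l} → Seen (es ++ [ e ]) l → Seen es l
      seen-++-miss miss seen with ∈-++⁻ es seen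
      ... | inj₁ old          = old
      ... | inj₂ (here yₗ≡e) = ⊥-elim (miss _ yₗ≡e)

      tracks-miss : ∀ {s} → (∀ l → lookup y l ≢ e) → Tracks s es → Tracks s (es ++ [ e ])
      tracks-miss {j , H} miss t = record
        { pointer-unseen = pointer-unseen ∘ seen-++-miss miss
        ; below-seen     = seen-++⁺ ∘ below-seen
        ; hit⇒seen       = λ j<l → seen-++⁺ ∘ hit⇒seen j<l
        ; seen⇒hit       = λ j<l → seen⇒hit j<l ∘ seen-++-miss miss
        }
        where open TracksAt t

      tracks-stay : ∀ {i j H H′} → lookup y i ≡ e → i ≢ j →
        (∀ {l} → l ∈ H′ → l ∈ H ⊎ l ≡ i) → (∀ {l} → l ∈ H → l ∈ H′) → (j Fin.< i → i ∈ H′) →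
        Tracks (j , H) es → Tracks (j , H′) (es ++ [ e ])
      tracks-stay {i} yᵢ≡e i≢j H′⊆H+i H⊆H′ i∈H′ t = record
        { pointer-unseen = λ seen → either pointer-unseen (i≢j ∘ sym) (seen-++⁻ yᵢ≡e seen)
        ; below-seen     = seen-++⁺ ∘ below-seen
        ; hit⇒seen       = λ j<l l∈H′ → either (seen-++⁺ ∘ hit⇒seen j<l) (λ { refl → seen-new yᵢ≡e }) (H′⊆H+i l∈H′)
        ; seen⇒hit       = λ j<l seen → either (H⊆H′ ∘ seen⇒hit j<l) (λ { refl → i∈H′ j<l }) (seen-++⁻ yᵢ≡e seen)
        }
        where open TracksAt t

      tracks-advance : ∀ {j H} → lookup y j ≡ e → length es < r → Tracks (j , H) es →
        Tracks (moveTo (j , H) (nextUnhit j H)) (es ++ [ e ])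
      tracks-advance {j} {H} yⱼ≡e short t = go (nextUnhit j H) (first-spec (unhit? j H))
        where
          open TracksAt t

          seen-unless-unhit : ∀ l → ¬ Unhit j H l → Seen (es ++ [ e ]) l
          seen-unless-unhit l hit with Finₚ.<-cmp l j
          ... | tri< l<j _ _ = seen-++⁺ (below-seen l<j)
          ... | tri≈ _ refl _ = seen-new yⱼ≡e
          ... | tri> _ _ j<l with l ∈? H
          ...   | yes l∈H = seen-++⁺ (hit⇒seen j<l l∈H)
          ...   | no l∉H  = ⊥-elim (hit (j<l , l∉H))

          go : ∀ m → First (Unhit j H) m → Tracks (moveTo (j , H) m) (es ++ [ e ])
          go nothing  (none all-hit) = ⊥-elim (<-irrefl refl (begin-strict
            R                    ≤⟨ all-seen⇒R≤length (λ l → seen-unless-unhit l (all-hit l)) ⟩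
            length (es ++ [ e ]) ≡⟨ trans (length-++ es) (+-comm (length es) 1) ⟩
            suc (length es)      ≤⟨ short ⟩
            r                    <⟨ n<1+n r ⟩
            R                    ∎))
            where open ≤-Reasoning
          go (just k) (found (j<k , k∉H) minimal) = record
            { pointer-unseen = λ seen → either (k∉H ∘ seen⇒hit j<k) (Finₚ.<⇒≢ j<k ∘ sym) (seen-++⁻ yⱼ≡e seen)
            ; below-seen     = λ {l} l<k → seen-unless-unhit l (minimal l<k)
            ; hit⇒seen       = λ k<l l∈H′ → seen-++⁺ (hit⇒seen (Finₚ.<-trans j<k k<l) (proj₁ (∈-filter⁻ (k Finₚ.<?_) l∈H′)))
            ; seen⇒hit       = λ {l} k<l seen → either
                (λ old → ∈-filter⁺ (k Finₚ.<?_) (seen⇒hit (Finₚ.<-trans j<k k<l) old) k<l)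
                (λ { refl → ⊥-elim (Finₚ.<-asym j<k k<l) })
                (seen-++⁻ yⱼ≡e seen)
            }

      tracks-react : ∀ {i j H} → lookup y i ≡ e → length es < r → Tracks (j , H) es →
        (c : Tri (j Fin.< i) (j ≡ i) (i Fin.< j)) (d : Dec (i ∈ H)) → Tracks (react j i H c d) (es ++ [ e ])
      tracks-react yᵢ≡e _ t (tri< j<i _ _) (no _) =
        tracks-stay yᵢ≡e (Finₚ.<⇒≢ j<i ∘ sym) (λ { (here refl) → inj₂ refl ; (there l∈H) → inj₁ l∈H })
          there (λ _ → here refl) t
      tracks-react yᵢ≡e _ t (tri< j<i _ _) (yes i∈H) =
        tracks-stay yᵢ≡e (Finₚ.<⇒≢ j<i ∘ sym) inj₁ id (λ _ → i∈H) t
      tracks-react yᵢ≡e short t (tri≈ _ refl _) _ = tracks-advance yᵢ≡e short t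
      tracks-react yᵢ≡e _ t (tri> _ _ i<j) _ =
        tracks-stay yᵢ≡e (Finₚ.<⇒≢ i<j) inj₁ id (λ j<i → ⊥-elim (Finₚ.<-asym i<j j<i)) t

      tracks-transition : ∀ {s} → length es < r → Tracks s es →
        ∀ m → First (λ l → lookup y l ≡ e) m → Tracks (transition s m) (es ++ [ e ])
      tracks-transition         _     t nothing  (none miss)   = tracks-miss miss t
      tracks-transition {j , H} short t (just i) (found yᵢ≡e _) = tracks-react yᵢ≡e short t (Finₚ.<-cmp j i) (i ∈? H)

      tracks-step : ∀ {s} → length es < r → Tracks s es → Tracks (step y s e) (es ++ [ e ])
      tracks-step short t = tracks-transition short t (position y e) (first-spec (valueAt? y e))

  module Implementation (w : ℕ) (R≤2^w : R ≤ 2 ^ w) (r<n : r < n) where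

    open InjectiveVectors n using (injectives; ∈-injectives; injectives-injective; resampling-bound)

    seedList : List Seed
    seedList = injectives

    pointerCode : Fin R → List Bool
    pointerCode i = bits w (Fin.inject≤ i R≤2^w)

    length-pointerCode : ∀ i → length (pointerCode i) ≡ w
    length-pointerCode i = length-bits w (Fin.inject≤ i R≤2^w)

    pointerCode-injective : ∀ {i j} → pointerCode i ≡ pointerCode j → i ≡ j
    pointerCode-injective {i} {j} eq = Finₚ.inject≤-injective R≤2^w R≤2^w i j (bits-injective w eq)

    open FixedWidthCode w pointerCode length-pointerCode pointerCode-injective
      using (codePair; codePair-prefixFree; length-codePair)

    canonicalSeed : Seed
    canonicalSeed = Vec.tabulate (λ l → Fin.inject≤ l r<n)

    canonicalSeed-injective : IsInjective canonicalSeed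
    canonicalSeed-injective {a} {b} eq = Finₚ.inject≤-injective r<n r<n a b (begin
      Fin.inject≤ a r<n       ≡⟨ Vecₚ.lookup∘tabulate (λ l → Fin.inject≤ l r<n) a ⟨
      lookup canonicalSeed a  ≡⟨ eq ⟩
      lookup canonicalSeed b  ≡⟨ Vecₚ.lookup∘tabulate (λ l → Fin.inject≤ l r<n) b ⟩
      Fin.inject≤ b r<n       ∎)
      where open ≡-Reasoning

    algorithm : Alg n
    algorithm = record
      { Ω          = Seed
      ; seeds      = seedList
      ; seeds-ne   = ∈-length (∈-injectives canonicalSeed canonicalSeed-injective)
      ; S          = State
      ; enc        = codePair
      ; prefixFree = codePair-prefixFree
      ; init       = λ _ → zero , []
      ; step       = step
      ; out        = λ y s → lookup y (proj₁ s)
      }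

    runStep : Adversary n → Seed → Config algorithm → Config algorithm
    runStep adv y c =
      let e = adv (proj₂ (proj₂ c)) ; s′ = step y (proj₁ c) e
      in s′ , proj₁ (proj₂ c) ++ [ e ] , proj₂ (proj₂ c) ++ [ lookup y (proj₁ s′) ]

    run-suc : ∀ adv y k → run algorithm y adv (suc k) ≡ runStep adv y (run algorithm y adv k)
    run-suc adv y k with run algorithm y adv k
    ... | _ = refl

    streamAt : Seed → Adversary n → ℕ → List (Fin n)
    streamAt y adv k = proj₁ (proj₂ (run algorithm y adv k))

    length-streamAt : ∀ adv y k → length (streamAt y adv k) ≡ k
    length-streamAt adv y zero    = refl
    length-streamAt adv y (suc k) rewrite run-suc adv y k
      with run algorithm y adv k | length-streamAt adv y k
    ... | s , es , os | refl = trans (length-++ es) (+-comm (length es) 1)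

    tracks-run : ∀ adv {y} (inj : IsInjective y) k → k ≤ r →
      Tracking.Tracks y inj (stateAt algorithm y adv k) (streamAt y adv k)
    tracks-run adv inj zero    _   = Tracking.tracks-init _ inj
    tracks-run adv {y} inj (suc k) k<r =
      subst (λ c → Tracks (proj₁ c) (proj₁ (proj₂ c))) (sym (run-suc adv y k))
        (tracks-runStep (run algorithm y adv k) (subst (_< r) (sym (length-streamAt adv y k)) k<r)
          (tracks-run adv inj k (<⇒≤ k<r)))
      where
        open Tracking y inj using (Tracks; tracks-step)
        tracks-runStep : ∀ c → length (proj₁ (proj₂ c)) < r → Tracks (proj₁ c) (proj₁ (proj₂ c)) →
          let c′ = runStep adv y c in Tracks (proj₁ c′) (proj₁ (proj₂ c′))
        tracks-runStep (s , es , os) = tracks-step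

    zeroError : ZeroError algorithm r
    zeroError adv y y∈ k _ k≤r =
      TracksAt.pointer-unseen (tracks-run adv (injectives-injective y∈) k k≤r)
      where open Tracking y (injectives-injective y∈) using (TracksAt)

    module SpaceAnalysis (adv : Adversary n) where

      stateOf : Seed → ℕ → State
      stateOf y t = stateAt algorithm y adv t

      inputAt : Seed → ℕ → Fin n
      inputAt y t = adv (proj₂ (proj₂ (run algorithm y adv t)))

      stateOf-suc : ∀ y t → stateOf y (suc t) ≡ step y (stateOf y t) (inputAt y t)
      stateOf-suc y t = cong proj₁ (run-suc adv y t)

      entryAt : Seed → ℕ → Maybe (Fin R)
      entryAt y t = entry (stateOf y t) (position y (inputAt y t))

      entries : Seed → ℕ → ℕ
      entries y zero    = 0
      entries y (suc t) = entries y t + size (entryAt y t)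

      entries≤ : ∀ y t → entries y t ≤ t
      entries≤ y zero    = z≤n
      entries≤ y (suc t) = ≤-trans (+-mono-≤ (entries≤ y t) (size≤1 (entryAt y t))) (≤-reflexive (+-comm t 1))

      length-hits≤entries : ∀ y t → length (proj₂ (stateOf y t)) ≤ entries y t
      length-hits≤entries y zero    = z≤n
      length-hits≤entries y (suc t) rewrite stateOf-suc y t =
        ≤-trans (length-transition (stateOf y t) (position y (inputAt y t))) (+-monoˡ-≤ _ (length-hits≤entries y t))

      untouched-earlier : ∀ {i} y {s t} → s ≤ t → Untouched i (stateOf y t) → Untouched i (stateOf y s)
      untouched-earlier {i} y {s} {t} s≤t u with m≤n⇒∃[o]m+o≡n s≤t
      ... | o , refl = go o u
        where
          go : ∀ o → Untouched i (stateOf y (s + o)) → Untouched i (stateOf y s)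
          go zero    u rewrite +-identityʳ s = u
          go (suc o) u rewrite +-suc s o =
            go o (untouched-transition⁻ (stateOf y (s + o)) (position y (inputAt y (s + o)))
                   (subst (Untouched i) (stateOf-suc y (s + o)) u))

      untouched⇒miss : ∀ {i y} → IsInjective y → ∀ t →
        Untouched i (stateOf y t) → Untouched i (stateOf y (suc t)) → lookup y i ≢ inputAt y t
      untouched⇒miss {i} {y} inj t u u′ yᵢ≡e = hit-while-untouched (stateOf y t) u
        (subst (λ m → Untouched i (transition (stateOf y t) m)) (position-hit y inj yᵢ≡e)
          (subst (Untouched i) (stateOf-suc y t) u′))

      module _ {i : Fin R} {x x′ : Seed} (inj : IsInjective x) (inj′ : IsInjective x′) (except : EqualExcept i x x′) where

        -- While i is untouched, neither x i nor x′ i is ever the input, so the runs cannot differ.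
        runs-agree : ∀ t → Untouched i (stateOf x t) → Untouched i (stateOf x′ t) →
          ∀ s → s ≤ t → run algorithm x adv s ≡ run algorithm x′ adv s
        runs-agree t u u′ zero    _   = refl
        runs-agree t u u′ (suc s) s<t = begin
          run algorithm x adv (suc s)       ≡⟨ run-suc adv x s ⟩
          runStep adv x (run algorithm x adv s)  ≡⟨ runStep-agree (run algorithm x adv s) e-miss e-miss′ pointer≢i ⟩
          runStep adv x′ (run algorithm x adv s) ≡⟨ cong (runStep adv x′) same ⟩
          runStep adv x′ (run algorithm x′ adv s) ≡⟨ run-suc adv x′ s ⟨
          run algorithm x′ adv (suc s)      ∎
          where
            open ≡-Reasoning
            same = runs-agree t u u′ s (<⇒≤ s<t)
            e-miss : lookup x i ≢ inputAt x s
            e-miss = untouched⇒miss inj s (untouched-earlier x (<⇒≤ s<t) u) (untouched-earlier x s<t u)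
            e-miss′ : lookup x′ i ≢ inputAt x s
            e-miss′ = subst (λ c → lookup x′ i ≢ adv (proj₂ (proj₂ c))) (sym same)
              (untouched⇒miss inj′ s (untouched-earlier x′ (<⇒≤ s<t) u′) (untouched-earlier x′ s<t u′))
            pointer≢i : proj₁ (step x (stateOf x s) (inputAt x s)) ≢ i
            pointer≢i = Finₚ.<⇒≢ (proj₁ (subst (Untouched i) (stateOf-suc x s) (untouched-earlier x s<t u)))

            runStep-agree : ∀ c → let e = adv (proj₂ (proj₂ c)) in
              lookup x i ≢ e → lookup x′ i ≢ e → proj₁ (step x (proj₁ c) e) ≢ i → runStep adv x c ≡ runStep adv x′ c
            runStep-agree c xᵢ≢e x′ᵢ≢e j′≢i =
              cong₂ (λ s′ o → s′ , proj₁ (proj₂ c) ++ [ e ] , proj₂ (proj₂ c) ++ [ o ]) same-state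
                (trans (except _ j′≢i) (cong (lookup x′ ∘ proj₁) same-state))
              where
                e = adv (proj₂ (proj₂ c))
                same-state : step x (proj₁ c) e ≡ step x′ (proj₁ c) e
                same-state = cong (transition (proj₁ c)) (position-agree x x′ except xᵢ≢e x′ᵢ≢e)

        entry-determines : ∀ t → entryAt x t ≡ just i → entryAt x′ t ≡ just i → lookup x i ≡ lookup x′ i
        entry-determines t eq eq′
          with hit , u ← entry-just (stateOf x t) (position x (inputAt x t)) eq
          with hit′ , u′ ← entry-just (stateOf x′ t) (position x′ (inputAt x′ t)) eq′ = begin
            lookup x i    ≡⟨ position-sound x hit ⟩
            inputAt x t   ≡⟨ cong (λ c → adv (proj₂ (proj₂ c))) (runs-agree t u u′ t ≤-refl) ⟩
            inputAt x′ t  ≡⟨ position-sound x′ hit′ ⟨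
            lookup x′ i   ∎
          where open ≡-Reasoning

      entered? : ∀ t i → Decidable (λ y → entryAt y t ≡ just i)
      entered? t i y = Maybeₚ.≡-dec Fin._≟_ (entryAt y t) (just i)

      entered-bound : ∀ t i → (n ∸ R) * length (filter (entered? t i) seedList) ≤ length seedList
      entered-bound t i = resampling-bound i (entered? t i)
        (λ {x} {x′} inj inj′ except → entry-determines {x = x} {x′} inj inj′ except t)

      sum-size-entryAt : ∀ t → (n ∸ R) * sum (map (λ y → size (entryAt y t)) seedList) ≤ R * length seedList
      sum-size-entryAt t = begin
        (n ∸ R) * sum (map (λ y → size (entryAt y t)) S)
          ≤⟨ *-monoʳ-≤ (n ∸ R) (sum-map-mono _ _ S (λ y → size≤sum-indicator (entryAt y t))) ⟩
        (n ∸ R) * sum (map (λ y → sum (map (λ i → indicator (entered? t i y)) (allFin R))) S)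
          ≡⟨ cong ((n ∸ R) *_) (sum-map-comm (λ y i → indicator (entered? t i y)) S (allFin R)) ⟩
        (n ∸ R) * sum (map (λ i → sum (map (indicator ∘ entered? t i) S)) (allFin R))
          ≡⟨ sum-map-*ˡ (n ∸ R) (λ i → sum (map (indicator ∘ entered? t i) S)) (allFin R) ⟨
        sum (map (λ i → (n ∸ R) * sum (map (indicator ∘ entered? t i) S)) (allFin R))
          ≤⟨ sum-map-≤-const _ (length S) (allFin R) (λ i →
               subst (λ c → (n ∸ R) * c ≤ length S) (length-filter≡sum-indicator (entered? t i) S) (entered-bound t i)) ⟩
        length (allFin R) * length S
          ≡⟨ cong (_* length S) (length-tabulate {n = R} id) ⟩
        R * length S
          ∎
        where
          open ≤-Reasoning
          S = seedList

      sum-entries : ∀ k → (n ∸ R) * sum (map (λ y → entries y k) seedList) ≤ k * (R * length seedList)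
      sum-entries zero    = ≤-reflexive (trans (cong ((n ∸ R) *_) (sum-map-zero seedList)) (*-zeroʳ (n ∸ R)))
      sum-entries (suc k) = begin
        (n ∸ R) * sum (map (λ y → entries y k + size (entryAt y k)) S)
          ≡⟨ cong ((n ∸ R) *_) (sum-map-+ (λ y → entries y k) (λ y → size (entryAt y k)) S) ⟩
        (n ∸ R) * (sum (map (λ y → entries y k) S) + sum (map (λ y → size (entryAt y k)) S))
          ≡⟨ *-distribˡ-+ (n ∸ R) _ _ ⟩
        (n ∸ R) * sum (map (λ y → entries y k) S) + (n ∸ R) * sum (map (λ y → size (entryAt y k)) S)
          ≤⟨ +-mono-≤ (sum-entries k) (sum-size-entryAt k) ⟩
        k * (R * length S) + R * length S
          ≡⟨ +-comm (k * (R * length S)) _ ⟩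
        suc k * (R * length S)
          ∎
        where
          open ≤-Reasoning
          S = seedList

      totalHits : ℕ → ℕ
      totalHits k = sum (map (λ y → length (proj₂ (stateOf y k))) seedList)

      totalHits-bound : ∀ k → k ≤ r → n * totalHits k ≤ 2 * (r * (R * length seedList))
      totalHits-bound k k≤r with n ≤? R + R
      ... | yes n≤2R = begin
        n * totalHits k
          ≤⟨ *-mono-≤ n≤2R (sum-map-≤-const _ r seedList (λ y →
               ≤-trans (length-hits≤entries y k) (≤-trans (entries≤ y k) k≤r))) ⟩
        (R + R) * (length seedList * r)
          ≡⟨ solve 3 (λ R s r → (R :+ R) :* (s :* r) := con 2 :* (r :* (R :* s))) refl R (length seedList) r ⟩
        2 * (r * (R * length seedList))
          ∎
        where open ≤-Reasoning
      ... | no n≰2R = begin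
        n * totalHits k
          ≤⟨ *-monoˡ-≤ (totalHits k) (m+m≤n⇒n≤[n∸m]+[n∸m] {R} (<⇒≤ (≰⇒> n≰2R))) ⟩
        ((n ∸ R) + (n ∸ R)) * totalHits k
          ≡⟨ solve 2 (λ d h → (d :+ d) :* h := con 2 :* (d :* h)) refl (n ∸ R) (totalHits k) ⟩
        2 * ((n ∸ R) * totalHits k)
          ≤⟨ *-monoʳ-≤ 2 (*-monoʳ-≤ (n ∸ R) (sum-map-mono _ _ seedList (λ y → length-hits≤entries y k))) ⟩
        2 * ((n ∸ R) * sum (map (λ y → entries y k) seedList))
          ≤⟨ *-monoʳ-≤ 2 (≤-trans (sum-entries k) (*-monoˡ-≤ (R * length seedList) k≤r)) ⟩
        2 * (r * (R * length seedList))
          ∎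
        where open ≤-Reasoning

      totalBits-bound : ∀ k → totalBits algorithm adv k ≤ suc w * (length seedList * 2 + totalHits k)
      totalBits-bound k = begin
        totalBits algorithm adv k
          ≤⟨ sum-map-mono _ _ seedList (λ y → length-codePair (proj₁ (stateOf y k)) (proj₂ (stateOf y k))) ⟩
        sum (map (λ y → suc w * (2 + length (proj₂ (stateOf y k)))) seedList)
          ≡⟨ sum-map-*ˡ (suc w) (λ y → 2 + length (proj₂ (stateOf y k))) seedList ⟩
        suc w * sum (map (λ y → 2 + length (proj₂ (stateOf y k))) seedList)
          ≡⟨ cong (suc w *_) (sum-map-+ (λ _ → 2) (λ y → length (proj₂ (stateOf y k))) seedList) ⟩
        suc w * (sum (map (λ _ → 2) seedList) + totalHits k)
          ≤⟨ *-monoʳ-≤ (suc w) (+-monoˡ-≤ (totalHits k) (sum-map-≤-const (λ _ → 2) 2 seedList (λ _ → ≤-refl))) ⟩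
        suc w * (length seedList * 2 + totalHits k)
          ∎
        where open ≤-Reasoning

space-arithmetic : ∀ {n r L s T bits} → r ≤ n → bits ≤ (2 + L) * (s * 2 + T) → n * T ≤ 2 * (r * (suc r * s)) →
  n * bits ≤ 8 * (n + r * r) * (1 + L) * s
space-arithmetic {n} {r} {L} {s} {T} {bits} r≤n bits≤ nT≤ = begin
  n * bits
    ≤⟨ *-monoʳ-≤ n bits≤ ⟩
  n * ((2 + L) * (s * 2 + T))
    ≡⟨ solve 4 (λ n L s T → n :* ((con 2 :+ L) :* (s :* con 2 :+ T))
                         := (con 2 :+ L) :* (con 2 :* (n :* s) :+ n :* T)) refl n L s T ⟩
  (2 + L) * (2 * (n * s) + n * T)
    ≤⟨ *-mono-≤ 2+L≤ (≤-trans (+-monoʳ-≤ (2 * (n * s)) nT≤) mixed≤) ⟩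
  2 * (1 + L) * (4 * ((n + r * r) * s))
    ≡⟨ solve 4 (λ n r L s → con 2 :* (con 1 :+ L) :* (con 4 :* ((n :+ r :* r) :* s))
                         := con 8 :* (n :+ r :* r) :* (con 1 :+ L) :* s) refl n r L s ⟩
  8 * (n + r * r) * (1 + L) * s
    ∎
  where
    open ≤-Reasoning
    2+L≤ : 2 + L ≤ 2 * (1 + L)
    2+L≤ = ≤-trans (+-monoʳ-≤ 2 (m≤m+n L L))
             (≤-reflexive (solve 1 (λ L → con 2 :+ (L :+ L) := con 2 :* (con 1 :+ L)) refl L))
    mixed≤ : 2 * (n * s) + 2 * (r * (suc r * s)) ≤ 4 * ((n + r * r) * s)
    mixed≤ = begin
      2 * (n * s) + 2 * (r * (suc r * s))
        ≡⟨ solve 3 (λ n r s → con 2 :* (n :* s) :+ con 2 :* (r :* ((con 1 :+ r) :* s))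
                           := con 2 :* (n :* s) :+ con 2 :* (r :* s) :+ con 2 :* (r :* r :* s)) refl n r s ⟩
      2 * (n * s) + 2 * (r * s) + 2 * (r * r * s)
        ≤⟨ +-mono-≤ (+-monoʳ-≤ (2 * (n * s)) (*-monoʳ-≤ 2 (*-monoˡ-≤ s r≤n))) (*-monoˡ-≤ (r * r * s) (m≤m+n 2 2)) ⟩
      2 * (n * s) + 2 * (n * s) + 4 * (r * r * s)
        ≡⟨ solve 3 (λ n r s → con 2 :* (n :* s) :+ con 2 :* (n :* s) :+ con 4 :* (r :* r :* s)
                           := con 4 :* ((n :+ r :* r) :* s)) refl n r s ⟩
      4 * ((n + r * r) * s)
        ∎

theorem6 : ∃ λ (C : ℕ) → ∀ (n r : ℕ) → 0 < r → r < n →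
    Σ (Alg n) λ A → ZeroError A r × SpaceBound A C r
theorem6 = 8 , λ n r 0<r r<n →
  let open PointerAlgorithm n r
      L = ⌈log₂ r ⌉
      R≤2^[1+L] : R ≤ 2 ^ suc L
      R≤2^[1+L] = ≤-trans (+-monoˡ-≤ r 0<r) (+-mono-≤ (≤2^⌈log₂⌉ r) (≤-trans (≤2^⌈log₂⌉ r) (m≤m+n _ 0)))
      open Implementation (suc L) R≤2^[1+L] r<n
  in algorithm , zeroError , λ adv k k≤r →
       let open SpaceAnalysis adv in
       space-arithmetic (<⇒≤ r<n) (totalBits-bound k) (totalHits-bound k k≤r)
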